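{- Let $G$ be a finite or infinite connected $2$-distinguishable graph. Then $|\mathrm{Aut}(G)|\cdot a(G)\le 2^{|G|}$ (as cardinals).
   Context: A set $S\subseteq V(G)$ is distinguishing if the identity is the only automorphism of $G$ mapping $S$ onto itself; $G$ is $2$-distinguishable if it has a distinguishing set. Subsets $S,S'$ of $V(G)$ are equivalent if some automorphism of $G$ maps $S$ onto $S'$; the asymmetrizing number $a(G)$ is the number of pairwise inequivalent distinguishing sets of $G$. $|G|$ denotes the cardinality of $V(G)$. -}

module Defs where

open import Level using (0ℓ)
open import Data.Bool using (Bool)
open import Data.Product using (Σ; ∃; _×_; _,_)
open import Relation.Nullary using (¬_)
open import Relation.Binary.Bundles using (Setoid)
open import Relation.Binary.PropositionalEquality
  using (_≡_; refl; sym; trans; setoid; _→-setoid_)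
open import Function.Bundles using (_↔_; Inverse; Injection)
open import Data.Product.Relation.Binary.Pointwise.NonDependent using (_×ₛ_)

record Graph : Set₁ where
  field
    V        : Set
    E        : V → V → Set
    E-sym    : ∀ {u v} → E u v → E v u
    E-irrefl : ∀ {v} → ¬ E v v
open Graph public

data Walk (G : Graph) : V G → V G → Set where
  here : ∀ {v} → Walk G v v
  step : ∀ {u w v} → E G u w → Walk G w v → Walk G u v

Connected : Graph → Set
Connected G = ∀ u v → Walk G u v

record Aut (G : Graph) : Set where
  field
    iso      : V G ↔ V G
    preserve : ∀ u v → E G u v → E G (Inverse.to iso u) (Inverse.to iso v)
    reflect  : ∀ u v → E G (Inverse.to iso u) (Inverse.to iso v) → E G u v
  to : V G → V G
  to = Inverse.to iso
  from : V G → V G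
  from = Inverse.from iso
open Aut public using (to; from)

_≈Aut_ : ∀ {G} → Aut G → Aut G → Set
_≈Aut_ {G} φ ψ = ∀ v → to φ v ≡ to ψ v

AutSetoid : Graph → Setoid 0ℓ 0ℓ
AutSetoid G = record
  { Carrier = Aut G
  ; _≈_ = _≈Aut_
  ; isEquivalence = record
    { refl = λ v → refl
    ; sym = λ p v → sym (p v)
    ; trans = λ p q v → trans (p v) (q v) } }

-- Subsets of V (the power set, 2^|G|), with pointwise (extensional) equality.
VSubset : Graph → Set
VSubset G = V G → Bool

PowerSetoid : Graph → Setoid 0ℓ 0ℓ
PowerSetoid G = V G →-setoid Bool

_≈S_ : ∀ {G} → VSubset G → VSubset G → Set
S ≈S T = ∀ v → S v ≡ T v

image : ∀ {G} → Aut G → VSubset G → VSubset G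
image φ S v = S (from φ v)

Distinguishing : (G : Graph) → VSubset G → Set
Distinguishing G S = (φ : Aut G) → _≈S_ {G} (image φ S) S → ∀ v → to φ v ≡ v

TwoDistinguishable : Graph → Set
TwoDistinguishable G = ∃ λ S → Distinguishing G S

Equivalent : (G : Graph) → VSubset G → VSubset G → Set
Equivalent G S S' = ∃ λ (φ : Aut G) → _≈S_ {G} (image φ S) S'

record InequivDistFamily (G : Graph) (I : Set) : Set where
  field
    set          : I → VSubset G
    distinguishing : ∀ i → Distinguishing G (set i)
    inequivalent : ∀ i j → Equivalent G (set i) (set j) → i ≡ j

-- Cardinal inequality |A| ≤ |B| between setoids: an injection.
_≼_ : Setoid 0ℓ 0ℓ → Setoid 0ℓ 0ℓ → Set
A ≼ B = Injection A B

-- The map (φ , i) ↦ φ(Sᵢ) is injective.  If φ(Sᵢ) = ψ(Sⱼ) then ψ⁻¹φ maps Sᵢ onto Sⱼ,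
-- so i = j because the family is pairwise inequivalent; then ψ⁻¹φ fixes Sᵢ, so it is
-- the identity because Sᵢ is distinguishing, i.e. φ = ψ.
module Submission where

open import Defs
open import Data.Product using (_,_; _×_)
open import Data.Product.Relation.Binary.Pointwise.NonDependent using (_×ₛ_)
open import Function.Bundles using (Inverse)
open import Function.Construct.Composition using (_↔-∘_)
open import Function.Construct.Symmetry using (↔-sym)
open import Relation.Binary.PropositionalEquality
  using (_≡_; refl; sym; trans; cong; subst₂; setoid; module ≡-Reasoning)

module _ {G : Graph} where

  infix 4 _≈_
  _≈_ : VSubset G → VSubset G → Set
  _≈_ = _≈S_ {G}

  to-from : (φ : Aut G) → ∀ v → to φ (from φ v) ≡ v
  to-from φ = Inverse.strictlyInverseˡ (Aut.iso φ)

  from-to : (φ : Aut G) → ∀ v → from φ (to φ v) ≡ v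
  from-to φ = Inverse.strictlyInverseʳ (Aut.iso φ)

  from-preserve : (φ : Aut G) → ∀ u v → E G u v → E G (from φ u) (from φ v)
  from-preserve φ u v e =
    Aut.reflect φ (from φ u) (from φ v) (subst₂ (E G) (sym (to-from φ u)) (sym (to-from φ v)) e)

  from-reflect : (φ : Aut G) → ∀ u v → E G (from φ u) (from φ v) → E G u v
  from-reflect φ u v e = subst₂ (E G) (to-from φ u) (to-from φ v) (Aut.preserve φ _ _ e)

  infix  10 _⁻¹ᴬ
  infixr 9 _∘ᴬ_

  _⁻¹ᴬ : Aut G → Aut G
  φ ⁻¹ᴬ = record
    { iso      = ↔-sym (Aut.iso φ)
    ; preserve = from-preserve φ
    ; reflect  = from-reflect φ
    }

  _∘ᴬ_ : Aut G → Aut G → Aut G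
  ψ ∘ᴬ φ = record
    { iso      = Aut.iso ψ ↔-∘ Aut.iso φ
    ; preserve = λ u v e → Aut.preserve ψ _ _ (Aut.preserve φ u v e)
    ; reflect  = λ u v e → Aut.reflect φ u v (Aut.reflect ψ _ _ e)
    }

  from-cong : (φ ψ : Aut G) → φ ≈Aut ψ → ∀ v → from φ v ≡ from ψ v
  from-cong φ ψ φ≈ψ v = begin
    from φ v                   ≡⟨ sym (from-to ψ (from φ v)) ⟩
    from ψ (to ψ (from φ v))   ≡⟨ cong (from ψ) (sym (φ≈ψ (from φ v))) ⟩
    from ψ (to φ (from φ v))   ≡⟨ cong (from ψ) (to-from φ v) ⟩
    from ψ v                   ∎
    where open ≡-Reasoning

  image-cong : (φ ψ : Aut G) → φ ≈Aut ψ → (S : VSubset G) → image φ S ≈ image ψ S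
  image-cong φ ψ φ≈ψ S v = cong S (from-cong φ ψ φ≈ψ v)

  image-cancelˡ : (φ ψ : Aut G) (S T : VSubset G) →
                  image φ S ≈ image ψ T → image (ψ ⁻¹ᴬ ∘ᴬ φ) S ≈ T
  image-cancelˡ φ ψ S T φS≈ψT v = trans (φS≈ψT (to ψ v)) (cong T (from-to ψ v))

  ≈Aut-from-identity : (φ ψ : Aut G) → (∀ v → to (ψ ⁻¹ᴬ ∘ᴬ φ) v ≡ v) → φ ≈Aut ψ
  ≈Aut-from-identity φ ψ ψ⁻¹φ≈id v = trans (sym (to-from ψ (to φ v))) (cong (to ψ) (ψ⁻¹φ≈id v))

lemma3p4 : (G : Graph) → Connected G → TwoDistinguishable G →
           (I : Set) → InequivDistFamily G I →
           (AutSetoid G ×ₛ setoid I) ≼ PowerSetoid G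
lemma3p4 G _ _ I F = record
  { to        = λ { (φ , i) → image φ (set i) }
  ; cong      = λ { {φ , i} {ψ , .i} (φ≈ψ , refl) → image-cong φ ψ φ≈ψ (set i) }
  ; injective = λ { {φ , i} {ψ , j} → image-injective φ i ψ j }
  }
  where
  open InequivDistFamily F

  image-injective : ∀ φ i ψ j → _≈S_ {G} (image φ (set i)) (image ψ (set j)) → φ ≈Aut ψ × i ≡ j
  image-injective φ i ψ j φSᵢ≈ψSⱼ
    with ψ⁻¹φSᵢ≈Sⱼ ← image-cancelˡ φ ψ (set i) (set j) φSᵢ≈ψSⱼ
    with refl ← inequivalent i j (ψ ⁻¹ᴬ ∘ᴬ φ , ψ⁻¹φSᵢ≈Sⱼ)
    = ≈Aut-from-identity φ ψ (distinguishing i (ψ ⁻¹ᴬ ∘ᴬ φ) ψ⁻¹φSᵢ≈Sⱼ) , refl
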